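{- Let $G$ be a clean graph, let $H$ be a hole in $G$, and let $v \in V(G) \setminus V(H)$. Then one of the following holds: \begin{enumerate} \item $v$ has no neighbour in $V(H)$; \item $|V(H)| = 5$ and $v$ is adjacent to every vertex of $V(H)$; \item $v$ has exactly two neighbours in $V(H)$, and they are adjacent (consecutive on $H$); \item $v$ has exactly three neighbours in $V(H)$, and they form a path of $H$. \end{enumerate}
   Context: All graphs are finite and simple. A hole is an induced cycle of length at least four; a graph is claw-free if it has no induced subgraph isomorphic to $K_{1,3}$. All paths are induced paths, and "contains" means contains as an induced subgraph. $N(v)$ denotes the set of neighbours of $v$. A jewel is a graph consisting of a hole $H = h_1 \text{ - } \cdots \text{ - } h_k \text{ - } h_1$ with $k \ge 4$ and a vertex $v \notin V(H)$ with $N(v) \cap V(H) = \{h_1,h_2,h_3,h_4\}$. A line wheel is a graph consisting of a hole $H = h_1 \text{ - } \cdots \text{ - } h_k \text{ - } h_1$ with $k \ge 6$ and a vertex $v \notin V(H)$ such that for some $i \in \{4,\dots,k-2\}$, $N(v) \cap V(H) = \{h_1,h_2,h_i,h_{i+1}\}$. A short prism is a graph consisting of a hole $h_1\text{ - }h_2\text{ - }h_3\text{ - }h_4\text{ - }h_1$ and an induced path $p_1\text{ - }\cdots\text{ - }p_k$ disjoint from $\{h_1,h_2,h_3,h_4\}$, such that $p_1$ is adjacent to $h_1$ and $h_2$, $p_k$ is adjacent to $h_3$ and $h_4$, and there are no other edges between $\{p_1,\dots,p_k\}$ and $\{h_1,h_2,h_3,h_4\}$. The seven-antihole is the complement of a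 cycle on seven vertices. A graph is clean if it is claw-free and contains no jewel, line wheel, short prism or seven-antihole. -}

module Defs where

open import Data.Nat using (ℕ; zero; suc; _≤_; _<_; _+_)
open import Data.Fin using (Fin; toℕ)
open import Data.Bool using (Bool; true; false)
open import Data.Product using (Σ; ∃; _×_; _,_)
open import Data.Sum using (_⊎_)
open import Relation.Binary.PropositionalEquality using (_≡_; _≢_)
open import Relation.Nullary using (¬_)
open import Function.Definitions using (Injective)
open import Function.Bundles using (_⇔_)

record Graph : Set where
  field
    n      : ℕ
    adj    : Fin n → Fin n → Bool
    sym    : ∀ u v → adj u v ≡ adj v u
    irrefl : ∀ u → adj u u ≡ false

open Graph public

V : Graph → Set
V G = Fin (n G)

E : (G : Graph) → V G → V G → Set
E G u v = adj G u v ≡ true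

CycAdj : (k : ℕ) → Fin k → Fin k → Set
CycAdj k i j =
  (toℕ j ≡ suc (toℕ i)) ⊎ (toℕ i ≡ suc (toℕ j)) ⊎
  ((toℕ i ≡ 0 × suc (toℕ j) ≡ k) ⊎ (toℕ j ≡ 0 × suc (toℕ i) ≡ k))

PathAdj : (k : ℕ) → Fin k → Fin k → Set
PathAdj k i j = (toℕ j ≡ suc (toℕ i)) ⊎ (toℕ i ≡ suc (toℕ j))

IsHole : (G : Graph) (k : ℕ) → (Fin k → V G) → Set
IsHole G k h =
  4 ≤ k × Injective _≡_ _≡_ h × (∀ i j → E G (h i) (h j) ⇔ CycAdj k i j)

IsPath : (G : Graph) (k : ℕ) → (Fin k → V G) → Set
IsPath G k p =
  1 ≤ k × Injective _≡_ _≡_ p × (∀ i j → E G (p i) (p j) ⇔ PathAdj k i j)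

NotIn : (G : Graph) {k : ℕ} → V G → (Fin k → V G) → Set
NotIn G v h = ∀ i → h i ≢ v

HasClaw : Graph → Set
HasClaw G = Σ (V G) λ c → Σ (V G) λ a → Σ (V G) λ b → Σ (V G) λ d →
  E G c a × E G c b × E G c d ×
  a ≢ b × a ≢ d × b ≢ d ×
  ¬ E G a b × ¬ E G a d × ¬ E G b d

ClawFree : Graph → Set
ClawFree G = ¬ HasClaw G

HasJewel : Graph → Set
HasJewel G = Σ ℕ λ k → Σ (Fin k → V G) λ h → Σ (V G) λ v →
  IsHole G k h × NotIn G v h × (∀ i → E G v (h i) ⇔ toℕ i < 4)

-- G contains a line wheel: hole h_0..h_{k-1} (k ≥ 6) and v with
-- N(v) ∩ H = {h_0, h_1, h_m, h_{m+1}} for some 3 ≤ m ≤ k-3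
-- (0-indexed; m corresponds to i-1 with i ∈ {4,...,k-2} in 1-indexed notation)
HasLineWheel : Graph → Set
HasLineWheel G = Σ ℕ λ k → Σ (Fin k → V G) λ h → Σ (V G) λ v → Σ ℕ λ m →
  6 ≤ k × IsHole G k h × NotIn G v h × 3 ≤ m × m + 3 ≤ k ×
  (∀ i → E G v (h i) ⇔
     ((toℕ i ≡ 0 ⊎ toℕ i ≡ 1) ⊎ (toℕ i ≡ m ⊎ toℕ i ≡ suc m)))

HasShortPrism : Graph → Set
HasShortPrism G = Σ (Fin 4 → V G) λ q → Σ ℕ λ k → Σ (Fin k → V G) λ p →
  IsHole G 4 q × IsPath G k p × (∀ i j → p i ≢ q j) ×
  (∀ i j → E G (p i) (q j) ⇔
     ((toℕ i ≡ 0 × (toℕ j ≡ 0 ⊎ toℕ j ≡ 1)) ⊎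
      (suc (toℕ i) ≡ k × (toℕ j ≡ 2 ⊎ toℕ j ≡ 3))))

HasSevenAntihole : Graph → Set
HasSevenAntihole G = Σ (Fin 7 → V G) λ f →
  Injective _≡_ _≡_ f × (∀ i j → i ≢ j → E G (f i) (f j) ⇔ (¬ CycAdj 7 i j))

Clean : Graph → Set
Clean G = ClawFree G × ¬ HasJewel G × ¬ HasLineWheel G ×
          ¬ HasShortPrism G × ¬ HasSevenAntihole G

-- Read the neighbourhood of v on H as a cyclic 0/1 word. A claw centred at v
-- forbids three neighbours that are pairwise non-consecutive on H; a claw
-- centred at a neighbour h_c forbids h_{c-1} and h_{c+1} both to be
-- non-neighbours. If v sees all of H, the first fact gives |H| ≤ 5 and a jewel
-- rules out |H| = 4. Otherwise rotate H so that v sees h_0 but not h_{k-1};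
-- then v sees h_1, and the only further neighbours can be h_2 (with h_3 this is
-- a jewel) or one later consecutive pair h_j h_{j+1} (a line wheel).
module Submission where

open import Defs hiding (sym)
open import Data.Bool as Bool using (true)
open import Data.Nat using (ℕ; zero; suc; pred; _+_; _*_; _≤_; _<_; z≤n; s≤s; z<s; s<s; _≤?_; NonZero)
open import Data.Nat.Properties
open import Data.Nat.DivMod
  using (_%_; _mod_; m%n<n; m<n⇒m%n≡m; n%n≡0; %-distribˡ-+; m%n%n≡m%n; [m+n]%n≡m%n; [m+kn]%n≡m%n)
open import Data.Fin using (Fin; toℕ)
open import Data.Fin.Properties using (toℕ-injective; toℕ<n; toℕ-fromℕ<; any?; all?; ¬∀⟶∃¬)
open import Data.Product using (Σ; ∃; _×_; _,_; proj₁; proj₂)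
open import Data.Sum using (_⊎_; inj₁; inj₂; [_,_])
import Data.Sum as Sum
open import Data.Sum.Function.Propositional using (_⊎-⇔_)
open import Data.Empty using (⊥; ⊥-elim)
open import Function using (_∘_)
open import Function.Bundles using (_⇔_; mk⇔; Equivalence)
import Function.Properties.Equivalence as ⇔
open import Relation.Binary using (tri<; tri≈; tri>)
open import Relation.Binary.PropositionalEquality
  using (_≡_; _≢_; refl; sym; trans; cong; subst; subst₂; ≢-sym; module ≡-Reasoning)
open import Relation.Nullary using (¬_; Dec; yes; no; contradiction)
open import Relation.Nullary.Decidable using (decidable-stable; _×-dec_)
open import Relation.Unary using (Decidable)

boundary : {P : ℕ → Set} → Decidable P → ∀ {a} d → ¬ P a → P (a + d) →
           ∃ λ t → ¬ P t × P (suc t)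
boundary {P} P? {a} zero    ¬pₐ pₐ₊₀ = contradiction (subst P (+-identityʳ a) pₐ₊₀) ¬pₐ
boundary {P} P? {a} (suc d) ¬pₐ pₐ₊ₛ with P? (suc a)
... | yes pₐ₊₁ = a , ¬pₐ , pₐ₊₁
... | no ¬pₐ₊₁ = boundary P? d ¬pₐ₊₁ (subst P (+-suc a d) pₐ₊ₛ)

least-in-range : {P : ℕ → Set} → Decidable P → ∀ lo hi →
  (∀ x → lo ≤ x → x < hi → ¬ P x) ⊎
  (∃ λ x → lo ≤ x × x < hi × P x × (∀ y → lo ≤ y → y < x → ¬ P y))
least-in-range P? lo zero = inj₁ λ _ _ ()
least-in-range P? lo (suc hi) with least-in-range P? lo hi
... | inj₂ (x , lo≤x , x<hi , pₓ , least) = inj₂ (x , lo≤x , m<n⇒m<1+n x<hi , pₓ , least)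
... | inj₁ none with lo ≤? hi ×-dec P? hi
...   | yes (lo≤hi , pₕ) = inj₂ (hi , lo≤hi , ≤-refl , pₕ , none)
...   | no ¬hit = inj₁ λ x lo≤x x≤hi →
  [ none x lo≤x , (λ { refl pₕ → ¬hit (lo≤x , pₕ) }) ] (m≤n⇒m<n∨m≡n (≤-pred x≤hi))

CycAdj-sym : ∀ {k} {i j : Fin k} → CycAdj k i j → CycAdj k j i
CycAdj-sym (inj₁ e)               = inj₂ (inj₁ e)
CycAdj-sym (inj₂ (inj₁ e))        = inj₁ e
CycAdj-sym (inj₂ (inj₂ (inj₁ e))) = inj₂ (inj₂ (inj₂ e))
CycAdj-sym (inj₂ (inj₂ (inj₂ e))) = inj₂ (inj₂ (inj₁ e))

¬CycAdj-far : ∀ {k} {i j : Fin k} → 2 + toℕ i ≤ toℕ j → 2 + toℕ j ≤ k + toℕ i → ¬ CycAdj k i j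
¬CycAdj-far {i = i} gap _ (inj₁ e) = 1+n≰n (≤-pred (subst (2 + toℕ i ≤_) e gap))
¬CycAdj-far {j = j} gap _ (inj₂ (inj₁ e)) =
  1+n≰n (≤-trans (m≤n+m (suc (toℕ j)) 2) (subst (λ z → 2 + z ≤ toℕ j) e gap))
¬CycAdj-far {k} {i} {j} _ wrap (inj₂ (inj₂ (inj₁ (i≡0 , 1+j≡k)))) =
  1+n≰n (subst (2 + toℕ j ≤_) (trans (cong (k +_) i≡0) (trans (+-identityʳ k) (sym 1+j≡k))) wrap)
¬CycAdj-far {i = i} gap _ (inj₂ (inj₂ (inj₂ (j≡0 , _)))) = n≮0 (subst (2 + toℕ i ≤_) j≡0 gap)

module _ {k : ℕ} .{{_ : NonZero k}} where

  toℕ-mod : ∀ x → toℕ (x mod k) ≡ x % k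
  toℕ-mod x = toℕ-fromℕ< (m%n<n x k)

  toℕ-mod-< : ∀ {x} → x < k → toℕ (x mod k) ≡ x
  toℕ-mod-< {x} x<k = trans (toℕ-mod x) (m<n⇒m%n≡m x<k)

  mod-cong : ∀ {x y} → x % k ≡ y % k → x mod k ≡ y mod k
  mod-cong {x} {y} e = toℕ-injective (trans (toℕ-mod x) (trans e (sym (toℕ-mod y))))

  mod-toℕ : ∀ i → toℕ i mod k ≡ i
  mod-toℕ i = toℕ-injective (toℕ-mod-< (toℕ<n i))

  [m%k+n]%k≡[m+n]%k : ∀ m n → (m % k + n) % k ≡ (m + n) % k
  [m%k+n]%k≡[m+n]%k m n = begin
    (m % k + n) % k         ≡⟨ %-distribˡ-+ (m % k) n k ⟩
    (m % k % k + n % k) % k ≡⟨ cong (λ z → (z + n % k) % k) (m%n%n≡m%n m k) ⟩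
    (m % k + n % k) % k     ≡⟨ %-distribˡ-+ m n k ⟨
    (m + n) % k             ∎
    where open ≡-Reasoning

  infixl 6 _⊕_ _⊖_

  _⊕_ : Fin k → ℕ → Fin k
  i ⊕ r = (toℕ i + r) mod k

  -- Rotating back by r is rotating forward by r * pred k, as r + r * pred k = r * k.
  _⊖_ : Fin k → ℕ → Fin k
  i ⊖ r = i ⊕ r * pred k

  next : Fin k → Fin k
  next i = i ⊕ 1

  mod-⊕ : ∀ x r → x mod k ⊕ r ≡ (x + r) mod k
  mod-⊕ x r = mod-cong (trans (cong (λ z → (z + r) % k) (toℕ-mod x)) ([m%k+n]%k≡[m+n]%k x r))

  ⊕-assoc : ∀ i r s → i ⊕ r ⊕ s ≡ i ⊕ (r + s)
  ⊕-assoc i r s = trans (mod-⊕ (toℕ i + r) s) (cong (_mod k) (+-assoc (toℕ i) r s))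

  ⊕-multiple : ∀ i m → i ⊕ m * k ≡ i
  ⊕-multiple i m = trans (mod-cong ([m+kn]%n≡m%n (toℕ i) m k)) (mod-toℕ i)

  r+r*pred[k]≡r*k : ∀ r → r + r * pred k ≡ r * k
  r+r*pred[k]≡r*k r = trans (sym (*-suc r (pred k))) (cong (r *_) (suc-pred k))

  ⊕-⊖ : ∀ i r → i ⊕ r ⊖ r ≡ i
  ⊕-⊖ i r = trans (⊕-assoc i r _) (trans (cong (i ⊕_) (r+r*pred[k]≡r*k r)) (⊕-multiple i r))

  ⊖-⊕ : ∀ i r → i ⊖ r ⊕ r ≡ i
  ⊖-⊕ i r = trans (⊕-assoc i _ r)
    (trans (cong (i ⊕_) (trans (+-comm _ r) (r+r*pred[k]≡r*k r))) (⊕-multiple i r))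

  ⊕-injective : ∀ r {i j} → i ⊕ r ≡ j ⊕ r → i ≡ j
  ⊕-injective r {i} {j} e = trans (sym (⊕-⊖ i r)) (trans (cong (_⊖ r) e) (⊕-⊖ j r))

  ⊖≡⇔≡⊕ : ∀ r {i a} → (i ⊖ r ≡ a) ⇔ (i ≡ a ⊕ r)
  ⊖≡⇔≡⊕ r {i} {a} = mk⇔
    (λ e → trans (sym (⊖-⊕ i r)) (cong (_⊕ r) e))
    (λ e → trans (cong (_⊖ r) e) (⊕-⊖ a r))

  next-⊕ : ∀ i r → next (i ⊕ r) ≡ next i ⊕ r
  next-⊕ i r = trans (⊕-assoc i r 1) (trans (cong (i ⊕_) (+-comm r 1)) (sym (⊕-assoc i 1 r)))

  next≡⇔ : ∀ {i j} → (next i ≡ j) ⇔ (toℕ j ≡ suc (toℕ i) ⊎ (toℕ j ≡ 0 × suc (toℕ i) ≡ k))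
  next≡⇔ {i} {j} with m≤n⇒m<n∨m≡n (toℕ<n i)
  ... | inj₁ 1+i<k = mk⇔
    (λ { refl → inj₁ toℕ-next })
    (λ { (inj₁ e) → toℕ-injective (trans toℕ-next (sym e))
       ; (inj₂ (_ , 1+i≡k)) → contradiction 1+i≡k (<⇒≢ 1+i<k) })
    where
    toℕ-next : toℕ (next i) ≡ suc (toℕ i)
    toℕ-next = trans (toℕ-mod (toℕ i + 1)) (trans (cong (_% k) (+-comm (toℕ i) 1)) (m<n⇒m%n≡m 1+i<k))
  ... | inj₂ 1+i≡k = mk⇔
    (λ { refl → inj₂ (toℕ-next , 1+i≡k) })
    (λ { (inj₁ e) → contradiction (trans e 1+i≡k) (<⇒≢ (toℕ<n j))
       ; (inj₂ (e , _)) → toℕ-injective (trans toℕ-next (sym e)) })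
    where
    toℕ-next : toℕ (next i) ≡ 0
    toℕ-next = trans (toℕ-mod (toℕ i + 1))
      (trans (cong (_% k) (trans (+-comm (toℕ i) 1) 1+i≡k)) (n%n≡0 k))

  CycAdj⇔next : ∀ {i j} → CycAdj k i j ⇔ (next i ≡ j ⊎ next j ≡ i)
  CycAdj⇔next {i} {j} = mk⇔ to from
    where
    to : CycAdj k i j → next i ≡ j ⊎ next j ≡ i
    to (inj₁ e)               = inj₁ (Equivalence.from next≡⇔ (inj₁ e))
    to (inj₂ (inj₁ e))        = inj₂ (Equivalence.from next≡⇔ (inj₁ e))
    to (inj₂ (inj₂ (inj₁ e))) = inj₂ (Equivalence.from next≡⇔ (inj₂ e))
    to (inj₂ (inj₂ (inj₂ e))) = inj₁ (Equivalence.from next≡⇔ (inj₂ e))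
    from : next i ≡ j ⊎ next j ≡ i → CycAdj k i j
    from (inj₁ e) = [ inj₁ , inj₂ ∘ inj₂ ∘ inj₂ ] (Equivalence.to next≡⇔ e)
    from (inj₂ e) = [ inj₂ ∘ inj₁ , inj₂ ∘ inj₂ ∘ inj₁ ] (Equivalence.to next≡⇔ e)

  CycAdj-⊕ : ∀ r {i j} → CycAdj k i j → CycAdj k (i ⊕ r) (j ⊕ r)
  CycAdj-⊕ r = Equivalence.from CycAdj⇔next ∘ Sum.map shift shift ∘ Equivalence.to CycAdj⇔next
    where
    shift : ∀ {i j} → next i ≡ j → next (i ⊕ r) ≡ j ⊕ r
    shift {i} e = trans (next-⊕ i r) (cong (_⊕ r) e)

  CycAdj-⊕⁻ : ∀ r {i j} → CycAdj k (i ⊕ r) (j ⊕ r) → CycAdj k i j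
  CycAdj-⊕⁻ r {i} {j} c = subst₂ (CycAdj k) (⊕-⊖ i r) (⊕-⊖ j r) (CycAdj-⊕ (r * pred k) c)

  adjacent-positions : ∀ {x} → suc x < k → CycAdj k (x mod k) (suc x mod k)
  adjacent-positions {x} 1+x<k =
    inj₁ (trans (toℕ-mod-< 1+x<k) (cong suc (sym (toℕ-mod-< (<-trans (n<1+n x) 1+x<k)))))

  distinct-positions : ∀ {x y} → x < y → y < k → x mod k ≢ y mod k
  distinct-positions x<y y<k e =
    <⇒≢ x<y (trans (sym (toℕ-mod-< (<-trans x<y y<k))) (trans (cong toℕ e) (toℕ-mod-< y<k)))

  distant-positions : ∀ {x y} → y < k → 2 + x ≤ y → 2 + y ≤ k + x → ¬ CycAdj k (x mod k) (y mod k)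
  distant-positions {x} {y} y<k gap wrap = ¬CycAdj-far
    (subst₂ (λ a b → 2 + a ≤ b) (sym x≡) (sym y≡) gap)
    (subst₂ (λ a b → 2 + b ≤ k + a) (sym x≡) (sym y≡) wrap)
    where
    x≡ : toℕ (x mod k) ≡ x
    x≡ = toℕ-mod-< (<-trans (≤-trans (n≤1+n (suc x)) gap) y<k)
    y≡ : toℕ (y mod k) ≡ y
    y≡ = toℕ-mod-< y<k

NbhdIsEdge : (G : Graph) (k : ℕ) → (Fin k → V G) → V G → Set
NbhdIsEdge G k h v = Σ (Fin k) λ a → Σ (Fin k) λ b → a ≢ b × CycAdj k a b ×
  (∀ i → E G v (h i) ⇔ (i ≡ a ⊎ i ≡ b))

NbhdIsPath3 : (G : Graph) (k : ℕ) → (Fin k → V G) → V G → Set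
NbhdIsPath3 G k h v = Σ (Fin k) λ a → Σ (Fin k) λ b → Σ (Fin k) λ c →
  a ≢ c × CycAdj k a b × CycAdj k b c × (∀ i → E G v (h i) ⇔ (i ≡ a ⊎ i ≡ b ⊎ i ≡ c))

E? : (G : Graph) (u w : V G) → Dec (E G u w)
E? G u w = adj G u w Bool.≟ true

module _ {G : Graph} {k : ℕ} .{{_ : NonZero k}} {h : Fin k → V G} (r : ℕ) where

  IsHole-rotate : IsHole G k h → IsHole G k (λ i → h (i ⊕ r))
  IsHole-rotate (4≤k , h-injective , h-adj) =
    4≤k , ⊕-injective r ∘ h-injective ,
    λ i j → mk⇔ (CycAdj-⊕⁻ r ∘ Equivalence.to (h-adj _ _)) (Equivalence.from (h-adj _ _) ∘ CycAdj-⊕ r)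

  nbhd-unrotate : ∀ {v} {P : Fin k → Set} → (∀ i → E G v (h (i ⊕ r)) ⇔ P i) →
                  ∀ i → E G v (h i) ⇔ P (i ⊖ r)
  nbhd-unrotate {v} {P} nbhd i = subst (λ j → E G v (h j) ⇔ P (i ⊖ r)) (⊖-⊕ i r) (nbhd (i ⊖ r))

  NbhdIsEdge-unrotate : ∀ {v} → NbhdIsEdge G k (λ i → h (i ⊕ r)) v → NbhdIsEdge G k h v
  NbhdIsEdge-unrotate (a , b , a≢b , ab , nbhd) =
    a ⊕ r , b ⊕ r , a≢b ∘ ⊕-injective r , CycAdj-⊕ r ab ,
    λ i → ⇔.trans (nbhd-unrotate nbhd i) (⊖≡⇔≡⊕ r ⊎-⇔ ⊖≡⇔≡⊕ r)

  NbhdIsPath3-unrotate : ∀ {v} → NbhdIsPath3 G k (λ i → h (i ⊕ r)) v → NbhdIsPath3 G k h v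
  NbhdIsPath3-unrotate (a , b , c , a≢c , ab , bc , nbhd) =
    a ⊕ r , b ⊕ r , c ⊕ r , a≢c ∘ ⊕-injective r , CycAdj-⊕ r ab , CycAdj-⊕ r bc ,
    λ i → ⇔.trans (nbhd-unrotate nbhd i) (⊖≡⇔≡⊕ r ⊎-⇔ ⊖≡⇔≡⊕ r ⊎-⇔ ⊖≡⇔≡⊕ r)

cyclic-boundary : ∀ {k} .{{_ : NonZero k}} {P : Fin k → Set} → Decidable P →
                  ∀ {i j} → P i → ¬ P j → ∃ λ t → ¬ P t × P (next t)
cyclic-boundary {k} {P} P? {i} {j} pᵢ ¬pⱼ = from-j (boundary (λ x → P? (j ⊕ x)) d ¬p[j⊕0] p[j⊕d])
  where
  d : ℕ
  d = toℕ (i ⊖ toℕ j)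
  ¬p[j⊕0] : ¬ P (j ⊕ 0)
  ¬p[j⊕0] = ¬pⱼ ∘ subst P (⊕-multiple j 0)
  p[j⊕d] : P (j ⊕ d)
  p[j⊕d] = subst P (sym (trans (cong (_mod k) (+-comm (toℕ j) d)) (⊖-⊕ i (toℕ j)))) pᵢ
  from-j : (∃ λ t → ¬ P (j ⊕ t) × P (j ⊕ suc t)) → ∃ λ t → ¬ P t × P (next t)
  from-j (t , ¬pₜ , pₜ₊₁) =
    j ⊕ t , ¬pₜ , subst P (sym (trans (⊕-assoc j t 1) (cong (j ⊕_) (+-comm t 1)))) pₜ₊₁

module _ (G : Graph) (cf : ClawFree G) {k} {h : Fin k → V G} (hole : IsHole G k h)
         {v : V G} (v∉h : NotIn G v h) where

  private
    h-injective : ∀ {i j} → h i ≡ h j → i ≡ j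
    h-injective = proj₁ (proj₂ hole)

    h-adj : ∀ {i j} → E G (h i) (h j) → CycAdj k i j
    h-adj = Equivalence.to (proj₂ (proj₂ hole) _ _)

    h-adj⁻ : ∀ {i j} → CycAdj k i j → E G (h i) (h j)
    h-adj⁻ = Equivalence.from (proj₂ (proj₂ hole) _ _)

  nbrs-not-independent : ∀ {a b c} → E G v (h a) → E G v (h b) → E G v (h c) →
    a ≢ b → a ≢ c → b ≢ c → ¬ CycAdj k a b → ¬ CycAdj k a c → ¬ CycAdj k b c → ⊥
  nbrs-not-independent va vb vc a≢b a≢c b≢c ¬ab ¬ac ¬bc =
    cf (v , _ , _ , _ , va , vb , vc ,
        a≢b ∘ h-injective , a≢c ∘ h-injective , b≢c ∘ h-injective ,
        ¬ab ∘ h-adj , ¬ac ∘ h-adj , ¬bc ∘ h-adj)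

  nbr-extends : ∀ {a c d} → CycAdj k c a → CycAdj k c d → a ≢ d → ¬ CycAdj k a d →
    ¬ E G v (h a) → E G v (h c) → E G v (h d)
  nbr-extends {a} {c} {d} ca cd a≢d ¬ad ¬va vc = decidable-stable (E? G v (h d)) λ ¬vd →
    cf (h c , v , h a , h d , trans (Graph.sym G (h c) v) vc , h-adj⁻ ca , h-adj⁻ cd ,
        (λ e → v∉h a (sym e)) , (λ e → v∉h d (sym e)) , a≢d ∘ h-injective ,
        ¬va , ¬vd , ¬ad ∘ h-adj)

module HoleNbrs (G : Graph) (cf : ClawFree G) {k' : ℕ} {h : Fin (suc k') → V G}
                (hole : IsHole G (suc k') h) {v : V G} (v∉h : NotIn G v h) where

  k : ℕ
  k = suc k'

  3≤k' : 3 ≤ k'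
  3≤k' = ≤-pred (proj₁ hole)

  Nbr : ℕ → Set
  Nbr x = E G v (h (x mod k))

  Nbr? : Decidable Nbr
  Nbr? x = E? G v (h (x mod k))

  Nbr-at : ∀ i {x} → toℕ i ≡ x → Nbr x → E G v (h i)
  Nbr-at i refl = subst (λ j → E G v (h j)) (mod-toℕ i)

  nbhd-⇔ : {P : Fin k → Set} → (∀ x → x < k → Nbr x → P (x mod k)) → (∀ i → P i → E G v (h i)) →
           ∀ i → E G v (h i) ⇔ P i
  nbhd-⇔ {P} Nbr⇒P P⇒nbr i = mk⇔
    (λ vᵢ → subst P (mod-toℕ i)
       (Nbr⇒P (toℕ i) (toℕ<n i) (subst (λ j → E G v (h j)) (sym (mod-toℕ i)) vᵢ)))
    (P⇒nbr i)

  no-spread-nbr-triple : ∀ {x y z} → z < k → 2 + x ≤ y → 2 + y ≤ z → 2 + z ≤ k + x →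
                         Nbr x → Nbr y → Nbr z → ⊥
  no-spread-nbr-triple {x} {y} {z} z<k x≪y y≪z z≪x nx ny nz =
    nbrs-not-independent G cf hole v∉h nx ny nz
      (distinct-positions x<y y<k) (distinct-positions (<-trans x<y y<z) z<k) (distinct-positions y<z z<k)
      (distant-positions y<k x≪y (≤-trans y≪z (≤-trans (<⇒≤ z<k) (m≤m+n k x))))
      (distant-positions z<k (≤-trans x≪y (≤-trans (m≤n+m y 2) y≪z)) z≪x)
      (distant-positions z<k y≪z (≤-trans z≪x (+-monoʳ-≤ k (<⇒≤ x<y))))
    where
    x<y : x < y
    x<y = ≤-trans (n≤1+n (suc x)) x≪y
    y<z : y < z
    y<z = ≤-trans (n≤1+n (suc y)) y≪z
    y<k : y < k
    y<k = <-trans y<z z<k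

  nbr-run-continues : ∀ {x} → 2 + x < k → ¬ Nbr x → Nbr (1 + x) → Nbr (2 + x)
  nbr-run-continues {x} 2+x<k = nbr-extends G cf hole v∉h
    (CycAdj-sym (adjacent-positions (<-trans (n<1+n (suc x)) 2+x<k))) (adjacent-positions 2+x<k)
    (distinct-positions (m<n+m x z<s) 2+x<k) (distant-positions 2+x<k ≤-refl (+-monoˡ-≤ x (proj₁ hole)))

  nbr-run-wraps : ¬ Nbr k' → Nbr 0 → Nbr 1
  nbr-run-wraps = nbr-extends G cf hole v∉h
    (inj₂ (inj₂ (inj₁ (toℕ-mod-< {k} {0} z<s , cong suc (toℕ-mod-< (n<1+n k'))))))
    (adjacent-positions (s≤s (≤-trans (s≤s z≤n) 3≤k')))
    (≢-sym (distinct-positions (≤-trans (s≤s (s≤s z≤n)) 3≤k') (n<1+n k')))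
    (distant-positions (n<1+n k') 3≤k' (≤-reflexive (cong suc (+-comm 1 k'))) ∘ CycAdj-sym)

  every-nbr⇒length-5 : ¬ HasJewel G → (∀ i → E G v (h i)) → k ≡ 5
  every-nbr⇒length-5 ¬jewel every with m≤n⇒m<n∨m≡n (proj₁ hole)
  ... | inj₂ 4≡k = ⊥-elim (¬jewel (k , h , v , hole , v∉h , nbhd-⇔ below-4 (λ i _ → every i)))
    where
    below-4 : ∀ x → x < k → Nbr x → toℕ (x mod k) < 4
    below-4 x x<k _ = subst (_< 4) (sym (toℕ-mod-< x<k)) (subst (x <_) (sym 4≡k) x<k)
  ... | inj₁ 4<k with m≤n⇒m<n∨m≡n 4<k
  ...   | inj₂ 5≡k = sym 5≡k
  ...   | inj₁ 5<k = ⊥-elim (no-spread-nbr-triple {0} {2} {4} 4<k ≤-refl ≤-refl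
                               (subst (6 ≤_) (sym (+-identityʳ k)) 5<k)
                               (every _) (every _) (every _))

  module FromEntry (¬nₗ : ¬ Nbr k') (n₀ : Nbr 0) where

    n₁ : Nbr 1
    n₁ = nbr-run-wraps ¬nₗ n₀

    1<k : 1 < k
    1<k = s≤s (≤-trans (s≤s z≤n) 3≤k')

    2<k : 2 < k
    2<k = s≤s (≤-trans (s≤s (s≤s z≤n)) 3≤k')

    nbr<k' : ∀ {x} → x < k → Nbr x → x < k'
    nbr<k' x<k nx = ≤∧≢⇒< (≤-pred x<k) λ { refl → ¬nₗ nx }

    no-nbr-beyond : ∀ {y x} → Nbr y → 2 ≤ y → 2 + y ≤ x → x < k → ¬ Nbr x
    no-nbr-beyond {x = x} ny 2≤y y≪x x<k nx = no-spread-nbr-triple x<k 2≤y y≪x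
      (subst (2 + x ≤_) (sym (+-identityʳ k)) (s≤s (nbr<k' x<k nx))) n₀ ny nx

    line-wheel : ¬ Nbr 2 → ∀ {j} → 3 ≤ j → j < k → Nbr j → (∀ y → 3 ≤ y → y < j → ¬ Nbr y) →
                 HasLineWheel G
    line-wheel ¬n₂ {suc j₀} 3≤j@(s≤s 2≤j₀) j<k nⱼ before-j =
      k , h , v , suc j₀ , s≤s (≤-trans (s≤s (s≤s 3≤j)) j+1<k') , hole , v∉h , 3≤j ,
      subst (_≤ k) (+-comm 3 (suc j₀)) (s≤s j+1<k') , nbhd-⇔ Nbr⇒S S⇒nbr
      where
      ¬nⱼ₋₁ : ¬ Nbr j₀
      ¬nⱼ₋₁ with m≤n⇒m<n∨m≡n 2≤j₀
      ... | inj₁ 3≤j₀ = before-j j₀ 3≤j₀ (n<1+n j₀)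
      ... | inj₂ refl = ¬n₂
      nⱼ₊₁ : Nbr (suc (suc j₀))
      nⱼ₊₁ = nbr-run-continues (s≤s (nbr<k' j<k nⱼ)) ¬nⱼ₋₁ nⱼ
      j+1<k' : suc (suc j₀) < k'
      j+1<k' = nbr<k' (s≤s (nbr<k' j<k nⱼ)) nⱼ₊₁
      S : ℕ → Set
      S x = (x ≡ 0 ⊎ x ≡ 1) ⊎ (x ≡ suc j₀ ⊎ x ≡ suc (suc j₀))
      Nbr⇒S′ : ∀ x → x < k → Nbr x → S x
      Nbr⇒S′ 0 _ _ = inj₁ (inj₁ refl)
      Nbr⇒S′ 1 _ _ = inj₁ (inj₂ refl)
      Nbr⇒S′ 2 _ n₂ = contradiction n₂ ¬n₂
      Nbr⇒S′ x@(suc (suc (suc _))) x<k nx with <-cmp x (suc j₀)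
      ... | tri< x<j _ _ = contradiction nx (before-j x (s≤s (s≤s (s≤s z≤n))) x<j)
      ... | tri≈ _ x≡j _ = inj₂ (inj₁ x≡j)
      ... | tri> _ _ j<x with m≤n⇒m<n∨m≡n j<x
      ...   | inj₂ j+1≡x = inj₂ (inj₂ (sym j+1≡x))
      ...   | inj₁ j+1<x = contradiction nx (no-nbr-beyond nⱼ (≤-trans (n≤1+n 2) 3≤j) j+1<x x<k)
      Nbr⇒S : ∀ x → x < k → Nbr x → S (toℕ (x mod k))
      Nbr⇒S x x<k nx = subst S (sym (toℕ-mod-< x<k)) (Nbr⇒S′ x x<k nx)
      S⇒nbr : ∀ i → S (toℕ i) → E G v (h i)
      S⇒nbr i (inj₁ (inj₁ e)) = Nbr-at i e n₀
      S⇒nbr i (inj₁ (inj₂ e)) = Nbr-at i e n₁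
      S⇒nbr i (inj₂ (inj₁ e)) = Nbr-at i e nⱼ
      S⇒nbr i (inj₂ (inj₂ e)) = Nbr-at i e nⱼ₊₁

    nbhd-edge : ¬ HasLineWheel G → ¬ Nbr 2 → NbhdIsEdge G k h v
    nbhd-edge ¬lw ¬n₂ with least-in-range Nbr? 3 k
    ... | inj₂ (j , 3≤j , j<k , nⱼ , before-j) = ⊥-elim (¬lw (line-wheel ¬n₂ 3≤j j<k nⱼ before-j))
    ... | inj₁ none =
      0 mod k , 1 mod k , distinct-positions z<s 1<k , adjacent-positions 1<k , nbhd-⇔ Nbr⇒01 01⇒nbr
      where
      Nbr⇒01 : ∀ x → x < k → Nbr x → x mod k ≡ 0 mod k ⊎ x mod k ≡ 1 mod k
      Nbr⇒01 0 _ _ = inj₁ refl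
      Nbr⇒01 1 _ _ = inj₂ refl
      Nbr⇒01 2 _ n₂ = contradiction n₂ ¬n₂
      Nbr⇒01 x@(suc (suc (suc _))) x<k nx = contradiction nx (none x (s≤s (s≤s (s≤s z≤n))) x<k)
      01⇒nbr : ∀ i → i ≡ 0 mod k ⊎ i ≡ 1 mod k → E G v (h i)
      01⇒nbr _ (inj₁ refl) = n₀
      01⇒nbr _ (inj₂ refl) = n₁

    nbhd-path : ¬ HasJewel G → Nbr 2 → NbhdIsPath3 G k h v
    nbhd-path ¬jewel n₂ with Nbr? 3
    ... | yes n₃ = ⊥-elim (¬jewel (k , h , v , hole , v∉h , nbhd-⇔ Nbr⇒<4 <4⇒nbr))
      where
      Nbr⇒<4 : ∀ x → x < k → Nbr x → toℕ (x mod k) < 4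
      Nbr⇒<4 0 x<k _ = subst (_< 4) (sym (toℕ-mod-< x<k)) z<s
      Nbr⇒<4 1 x<k _ = subst (_< 4) (sym (toℕ-mod-< x<k)) (s<s z<s)
      Nbr⇒<4 2 x<k _ = subst (_< 4) (sym (toℕ-mod-< x<k)) (s<s (s<s z<s))
      Nbr⇒<4 3 x<k _ = subst (_< 4) (sym (toℕ-mod-< x<k)) (s<s (s<s (s<s z<s)))
      Nbr⇒<4 x@(suc (suc (suc (suc _)))) x<k nx =
        contradiction nx (no-nbr-beyond n₂ ≤-refl (s≤s (s≤s (s≤s (s≤s z≤n)))) x<k)
      <4⇒nbr′ : ∀ x → x < 4 → Nbr x
      <4⇒nbr′ 0 _ = n₀
      <4⇒nbr′ 1 _ = n₁
      <4⇒nbr′ 2 _ = n₂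
      <4⇒nbr′ 3 _ = n₃
      <4⇒nbr′ (suc (suc (suc (suc _)))) (s≤s (s≤s (s≤s (s≤s ()))))
      <4⇒nbr : ∀ i → toℕ i < 4 → E G v (h i)
      <4⇒nbr i i<4 = Nbr-at i refl (<4⇒nbr′ (toℕ i) i<4)
    ... | no ¬n₃ =
      0 mod k , 1 mod k , 2 mod k , distinct-positions z<s 2<k , adjacent-positions 1<k ,
      adjacent-positions 2<k , nbhd-⇔ Nbr⇒012 012⇒nbr
      where
      Nbr⇒012 : ∀ x → x < k → Nbr x → x mod k ≡ 0 mod k ⊎ x mod k ≡ 1 mod k ⊎ x mod k ≡ 2 mod k
      Nbr⇒012 0 _ _ = inj₁ refl
      Nbr⇒012 1 _ _ = inj₂ (inj₁ refl)
      Nbr⇒012 2 _ _ = inj₂ (inj₂ refl)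
      Nbr⇒012 3 _ n₃ = contradiction n₃ ¬n₃
      Nbr⇒012 x@(suc (suc (suc (suc _)))) x<k nx =
        contradiction nx (no-nbr-beyond n₂ ≤-refl (s≤s (s≤s (s≤s (s≤s z≤n)))) x<k)
      012⇒nbr : ∀ i → i ≡ 0 mod k ⊎ i ≡ 1 mod k ⊎ i ≡ 2 mod k → E G v (h i)
      012⇒nbr _ (inj₁ refl) = n₀
      012⇒nbr _ (inj₂ (inj₁ refl)) = n₁
      012⇒nbr _ (inj₂ (inj₂ refl)) = n₂

    entry-nbhd : ¬ HasJewel G → ¬ HasLineWheel G → NbhdIsEdge G k h v ⊎ NbhdIsPath3 G k h v
    entry-nbhd ¬jewel ¬lw with Nbr? 2
    ... | yes n₂ = inj₂ (nbhd-path ¬jewel n₂)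
    ... | no ¬n₂ = inj₁ (nbhd-edge ¬lw ¬n₂)

partial-nbhd : (G : Graph) → ClawFree G → ¬ HasJewel G → ¬ HasLineWheel G →
  ∀ {k'} {h : Fin (suc k') → V G} → IsHole G (suc k') h → ∀ {v} → NotIn G v h →
  ∀ {i j} → E G v (h i) → ¬ E G v (h j) →
  NbhdIsEdge G (suc k') h v ⊎ NbhdIsPath3 G (suc k') h v
partial-nbhd G cf ¬jewel ¬lw {k'} {h} hole {v} v∉h vᵢ ¬vⱼ
  with cyclic-boundary (λ i → E? G v (h i)) vᵢ ¬vⱼ
... | t , ¬vₜ , vₜ₊₁ =
  Sum.map (NbhdIsEdge-unrotate {G} {h = h} r) (NbhdIsPath3-unrotate {G} {h = h} r) (entry-nbhd ¬jewel ¬lw)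
  where
  r : ℕ
  r = suc (toℕ t)
  open HoleNbrs G cf (IsHole-rotate {G} r hole) (λ i → v∉h (i ⊕ r))
  first⊕r : 0 mod k ⊕ r ≡ next t
  first⊕r = trans (mod-⊕ 0 r) (cong (_mod k) (+-comm 1 (toℕ t)))
  last⊕r : k' mod k ⊕ r ≡ t
  last⊕r = begin
    k' mod k ⊕ suc (toℕ t)   ≡⟨ mod-⊕ k' (suc (toℕ t)) ⟩
    (k' + suc (toℕ t)) mod k ≡⟨ cong (_mod k) (trans (+-suc k' (toℕ t)) (+-comm k (toℕ t))) ⟩
    (toℕ t + k) mod k        ≡⟨ mod-cong {x = toℕ t + k} {toℕ t} ([m+n]%n≡m%n (toℕ t) k) ⟩
    toℕ t mod k              ≡⟨ mod-toℕ t ⟩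
    t                        ∎
    where open ≡-Reasoning
  v₀ : Nbr 0
  v₀ = subst (λ j → E G v (h j)) (sym first⊕r) vₜ₊₁
  ¬vₗ : ¬ Nbr k'
  ¬vₗ = ¬vₜ ∘ subst (λ j → E G v (h j)) last⊕r
  open FromEntry ¬vₗ v₀

mainTheorem4 : (G : Graph) → Clean G →
    (k : ℕ) (h : Fin k → V G) → IsHole G k h →
    (v : V G) → NotIn G v h →
    (∀ i → ¬ E G v (h i))
    ⊎ (k ≡ 5 × (∀ i → E G v (h i)))
    ⊎ (Σ (Fin k) λ a → Σ (Fin k) λ b → a ≢ b × CycAdj k a b ×
        (∀ i → E G v (h i) ⇔ (i ≡ a ⊎ i ≡ b)))
    ⊎ (Σ (Fin k) λ a → Σ (Fin k) λ b → Σ (Fin k) λ c →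
        a ≢ c × CycAdj k a b × CycAdj k b c ×
        (∀ i → E G v (h i) ⇔ (i ≡ a ⊎ i ≡ b ⊎ i ≡ c)))
mainTheorem4 G cl zero h (() , _) v v∉h
mainTheorem4 G (cf , ¬jewel , ¬lw , _) (suc k') h hole v v∉h
  with any? (λ i → E? G v (h i)) | all? (λ i → E? G v (h i))
... | no ¬some     | _         = inj₁ λ i vᵢ → ¬some (i , vᵢ)
... | yes _        | yes every =
  inj₂ (inj₁ (HoleNbrs.every-nbr⇒length-5 G cf hole v∉h ¬jewel every , every))
... | yes (_ , vᵢ) | no ¬every with ¬∀⟶∃¬ _ (λ i → E G v (h i)) (λ i → E? G v (h i)) ¬every
...   | _ , ¬vⱼ = inj₂ (inj₂ (partial-nbhd G cf ¬jewel ¬lw hole v∉h vᵢ ¬vⱼ))
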